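{- Let $\mathcal{S}=(C,\Sigma,\mathcal{P})$ be a system of interacting components with components $C_1,\dots,C_m$, and let $Com$ be a deployable communication architecture for $\mathcal{S}$. Let $c=(l_1,e_1,\dots,l_m,e_m)$ be any configuration of $\mathcal{S}$. Then: (a) If $\sigma\in\Sigma$ is globally enabled at $c$, then $\sigma$ is distributively-enabled at $c$. (b) The set of distributively-enabled interactions at $c$ equals $\Sigma_c$, the set of globally enabled interactions at $c$. (c) If $c$ has no distributively-enabled interaction, then $c$ has no globally enabled interaction.
   Context: A component is $C_i=(L_i,V_i,\Sigma_i,T_i,l^0_i,e^0_i)$: $L_i$ a finite nonempty set of locations, $V_i$ a finite set of Boolean variables, $\Sigma_i\subseteq\Sigma$ a nonempty set of interaction labels, $T_i$ a set of transitions $(l,g,\sigma,f,l')$ with $l,l'\in L_i$, guard $g$ a propositional formula over $V_i$, $\sigma\in\Sigma_i$, and update relation $f:V_i\to 2^{\{\mathtt{True},\mathtt{False}\}}\setminus\{\emptyset\}$; $l^0_i,e^0_i$ are the initial location and evaluation. A system is $\mathcal{S}=(C=\bigcup_{i=1}^m C_i,\Sigma,\mathcal{P})$ where $\mathcal{P}\subseteq\Sigma\times\Sigma$ is an irreflexive, transitive priority relation; write $\sigma\prec\tau$ for $(\sigma,\tau)\in\mathcal{P}$ ($\tau$ has higher priority). A configuration is $c=(l_1,e_1,\dots,l_m,e_m)$ with $l_i\in L_i$ and $e_i$ an evaluation of $V_i$. Joint participation holds for $\sigma$ at $c$ if for every $i$ with $\sigma\in\Sigma_i$ there is a transition $(l_i,g_i,\sigma,f_i,l_i')\in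 T_i$ with $e_i(g_i)=\mathtt{True}$. $\sigma$ is globally enabled at $c$ if joint participation holds for $\sigma$ and there is no $\tau$ with $\sigma\prec\tau$ for which joint participation holds; $\Sigma_c$ is the set of globally enabled interactions. A communication architecture $Com$ is a set of ordered pairs $(C_i,C_j)$, written $C_i\leadsto C_j$ ("$C_i$ informs $C_j$"). It is deployable if for all $\sigma,\tau\in\Sigma$ and $i,j$: (1) $C_i\leadsto C_i\in Com$ for all $i$; (2) if $\sigma\in\Sigma_i\cap\Sigma_j$ then $C_i\leadsto C_j$ and $C_j\leadsto C_i$ are in $Com$; (3) if $\sigma\prec\tau\in\mathcal{P}$, $\sigma\in\Sigma_j$ and $\tau\in\Sigma_i$, then $C_i\leadsto C_j\in Com$. An interaction $\sigma$ is visible by $C_j$ if $C_i\leadsto C_j\in Com$ for all $i$ with $\sigma\in\Sigma_i$. An interaction $\sigma$ is distributively-enabled at $c$ if (1) for all $i$ with $\sigma\in\Sigma_i$, $\sigma$ is visible by $C_i$ and there exists $(l_i,g_i,\sigma,\_,\_)\in T_i$ with $e_i(g_i)=\mathtt{True}$; and (2) for all $\tau\in\Sigma$ with $\sigma\prec\tau$, $\tau$ is visible by $C_i$ (for the $i$ with $\sigma\in\Sigma_i$), and there is a $j$ with $\tau\in\Sigma_j$ such that either there is no transition $(l_j,g_j,\tau,\_,\_)\in T_j$ or every such transition has $e_j(g_j)=\mathtt{False}$. -}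

module Defs where

open import Data.Nat using (ℕ)
open import Data.Fin using (Fin)
open import Data.Bool using (Bool; true; false; _∧_; _∨_; not)
open import Data.List using (List)
open import Data.List.Membership.Propositional using (_∈_)
open import Data.Product using (Σ; ∃; _×_)
open import Data.Sum using (_⊎_)
open import Relation.Nullary using (¬_)
open import Relation.Binary.PropositionalEquality using (_≡_)

data Formula (n : ℕ) : Set where
  tt  : Formula n
  ff  : Formula n
  var : Fin n → Formula n
  neg : Formula n → Formula n
  and : Formula n → Formula n → Formula n
  or  : Formula n → Formula n → Formula n

Eval : ℕ → Set
Eval n = Fin n → Bool

evalF : ∀ {n} → Eval n → Formula n → Bool
evalF e tt        = true
evalF e ff        = false
evalF e (var x)   = e x
evalF e (neg g)   = not (evalF e g)
evalF e (and g h) = evalF e g ∧ evalF e h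
evalF e (or g h)  = evalF e g ∨ evalF e h

record NonEmptyBoolSet : Set where
  field
    mayTrue  : Bool
    mayFalse : Bool
    nonempty : mayTrue ∨ mayFalse ≡ true

record Transition (nΣ nL nV : ℕ) (Σi : Fin nΣ → Bool) : Set where
  constructor trans
  field
    src    : Fin nL
    guard  : Formula nV
    label  : Fin nΣ
    label∈ : Σi label ≡ true
    update : Fin nV → NonEmptyBoolSet  -- f : V_i → 2^{True,False} \ {∅}
    tgt    : Fin nL

-- Component C_i = (L_i, V_i, Σ_i, T_i, l⁰_i, e⁰_i) with L_i = Fin nL,
-- V_i = Fin nV, Σ_i ⊆ Σ given by its characteristic function.
-- L_i is nonempty since it contains l⁰.
record Component (nΣ : ℕ) : Set where
  field
    nL  : ℕ
    nV  : ℕ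
    Σi  : Fin nΣ → Bool
    Σi-nonempty : ∃ λ σ → Σi σ ≡ true
    T   : List (Transition nΣ nL nV Σi)
    l⁰  : Fin nL
    e⁰  : Eval nV

-- System S = (C, Σ, P) with components C_1..C_m (indexed by Fin m),
-- labels Σ = Fin nΣ and priority P ⊆ Σ × Σ (characteristic function).
record System : Set where
  field
    nΣ   : ℕ
    m    : ℕ
    comp : Fin m → Component nΣ
    P    : Fin nΣ → Fin nΣ → Bool
    P-irrefl : ∀ σ → ¬ (P σ σ ≡ true)
    P-trans  : ∀ σ τ ρ → P σ τ ≡ true → P τ ρ ≡ true → P σ ρ ≡ true

module _ (S : System) where
  open System S
  open Component

  -- σ ≺ τ  (τ has higher priority)
  _≺_ : Fin nΣ → Fin nΣ → Set
  σ ≺ τ = P σ τ ≡ true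

  _∈Σ_ : Fin nΣ → Fin m → Set
  σ ∈Σ i = Σi (comp i) σ ≡ true

  record Config : Set where
    field
      loc  : (i : Fin m) → Fin (nL (comp i))
      eval : (i : Fin m) → Eval (nV (comp i))
  open Config

  EnabledTrans : Config → Fin m → Fin nΣ → Set
  EnabledTrans c i σ =
    Σ (Transition nΣ (nL (comp i)) (nV (comp i)) (Σi (comp i))) λ t →
      t ∈ T (comp i) × Transition.src t ≡ loc c i × Transition.label t ≡ σ
        × evalF (eval c i) (Transition.guard t) ≡ true

  NoEnabledTrans : Config → Fin m → Fin nΣ → Set
  NoEnabledTrans c j τ =
    (¬ Σ (Transition nΣ (nL (comp j)) (nV (comp j)) (Σi (comp j))) λ t →
        t ∈ T (comp j) × Transition.src t ≡ loc c j × Transition.label t ≡ τ)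
    ⊎ (∀ t → t ∈ T (comp j) → Transition.src t ≡ loc c j → Transition.label t ≡ τ
             → evalF (eval c j) (Transition.guard t) ≡ false)

  JointParticipation : Config → Fin nΣ → Set
  JointParticipation c σ = ∀ i → σ ∈Σ i → EnabledTrans c i σ

  GloballyEnabled : Config → Fin nΣ → Set
  GloballyEnabled c σ =
    JointParticipation c σ × (¬ Σ (Fin nΣ) λ τ → σ ≺ τ × JointParticipation c τ)

  ComArch : Set
  ComArch = Fin m → Fin m → Bool

  _⇝[_]_ : Fin m → ComArch → Fin m → Set
  i ⇝[ Com ] j = Com i j ≡ true

  Deployable : ComArch → Set
  Deployable Com =
    (∀ i → i ⇝[ Com ] i)
    × (∀ σ i j → σ ∈Σ i → σ ∈Σ j → (i ⇝[ Com ] j) × (j ⇝[ Com ] i))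
    × (∀ σ τ i j → σ ≺ τ → σ ∈Σ j → τ ∈Σ i → i ⇝[ Com ] j)

  VisibleBy : ComArch → Fin nΣ → Fin m → Set
  VisibleBy Com σ j = ∀ i → σ ∈Σ i → i ⇝[ Com ] j

  DistributivelyEnabled : ComArch → Config → Fin nΣ → Set
  DistributivelyEnabled Com c σ =
    (∀ i → σ ∈Σ i → VisibleBy Com σ i × EnabledTrans c i σ)
    × (∀ τ → σ ≺ τ →
         (∀ i → σ ∈Σ i → VisibleBy Com τ i)
         × Σ (Fin m) λ j → τ ∈Σ j × NoEnabledTrans c j τ)

module Submission where

-- Distributed enabledness consists of two kinds of conditions:
--   * visibility conditions, which hold for every interaction under a
--     deployable architecture (shared labels and priority edges are exactly
--     the communication links that deployability demands);
--   * local conditions, which restate global enabledness: joint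
--     participation for σ itself, and for every τ of higher priority a
--     component of τ that blocks it (has no enabled τ-transition).
-- The only non-trivial step is that "τ lacks joint participation" yields a
-- blocking component.  This is constructive because, for a fixed
-- configuration, having an enabled τ-transition is decidable (transition
-- lists are finite, locations and labels have decidable equality) and the
-- components are indexed by a finite type.

open import Defs
open import Data.Fin using (Fin)
open import Data.Product using (_×_)
open import Relation.Nullary using (¬_)
open import Function.Bundles using (_⇔_)

open import Data.Bool using (true)
open import Data.Bool.Properties using (¬-not) renaming (_≟_ to _≟ᵇ_)
open import Data.Empty using (⊥-elim)
open import Data.Fin.Properties using (¬∀⟶∃¬) renaming (_≟_ to _≟ᶠ_)
open import Data.List.Relation.Unary.Any using (any?)
open import Data.List.Membership.Propositional using (find; lose)
open import Data.Product using (Σ; _,_; proj₁; proj₂)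
open import Data.Sum using (inj₁; inj₂)
open import Function.Bundles using (mk⇔)
open import Relation.Nullary using (Dec; yes; no; contradiction)
open import Relation.Nullary.Decidable using (map′; _×-dec_; _→-dec_)
open import Relation.Binary.PropositionalEquality using (_≡_; sym) renaming (trans to ≡-trans)

module _ (S : System) where
  open System S
  open Component
  open Config

  Blocker : Config S → Fin nΣ → Set
  Blocker c τ = Σ (Fin m) λ j → _∈Σ_ S τ j × NoEnabledTrans S c j τ

  enabledTrans? : ∀ c i σ → Dec (EnabledTrans S c i σ)
  enabledTrans? c i σ =
    map′ find (λ (t , t∈T , enabled) → lose t∈T enabled) (any? isEnabled (T (comp i)))
    where
    isEnabled : ∀ t → Dec (Transition.src t ≡ loc c i
                          × Transition.label t ≡ σ
                          × evalF (eval c i) (Transition.guard t) ≡ true)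
    isEnabled t = (Transition.src t ≟ᶠ loc c i)
                  ×-dec (Transition.label t ≟ᶠ σ)
                  ×-dec (evalF (eval c i) (Transition.guard t) ≟ᵇ true)

  noEnabledTrans : ∀ c j τ → ¬ EnabledTrans S c j τ → NoEnabledTrans S c j τ
  noEnabledTrans c j τ ¬enabled = inj₂ λ t t∈T src label →
    ¬-not λ guard → ¬enabled (t , t∈T , src , label , guard)

  noEnabledTrans⇒¬enabled : ∀ c j τ → NoEnabledTrans S c j τ → ¬ EnabledTrans S c j τ
  noEnabledTrans⇒¬enabled c j τ (inj₁ noTrans) (t , t∈T , src , label , _) =
    noTrans (t , t∈T , src , label)
  noEnabledTrans⇒¬enabled c j τ (inj₂ allFalse) (t , t∈T , src , label , guard) =
    contradiction (≡-trans (sym guard) (allFalse t t∈T src label)) λ ()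

  blocker⇒¬joint : ∀ c τ → Blocker c τ → ¬ JointParticipation S c τ
  blocker⇒¬joint c τ (j , τ∈Σj , noEnabled) joint =
    noEnabledTrans⇒¬enabled c j τ noEnabled (joint j τ∈Σj)

  ¬joint⇒blocker : ∀ c τ → ¬ JointParticipation S c τ → Blocker c τ
  ¬joint⇒blocker c τ ¬joint
    with ¬∀⟶∃¬ m _ (λ i → (Σi (comp i) τ ≟ᵇ true) →-dec enabledTrans? c i τ) ¬joint
  ... | j , ¬participates with Σi (comp j) τ ≟ᵇ true
  ...   | yes τ∈Σj = j , τ∈Σj , noEnabledTrans c j τ (λ enabled → ¬participates (λ _ → enabled))
  ...   | no τ∉Σj = ⊥-elim (¬participates (λ τ∈Σj → contradiction τ∈Σj τ∉Σj))

  module _ (Com : ComArch S) (deployable : Deployable S Com) where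

    sharedVisible : ∀ σ i → _∈Σ_ S σ i → VisibleBy S Com σ i
    sharedVisible σ i σ∈Σi k σ∈Σk = proj₂ (proj₁ (proj₂ deployable) σ i k σ∈Σi σ∈Σk)

    priorityVisible : ∀ σ τ → _≺_ S σ τ → ∀ i → _∈Σ_ S σ i → VisibleBy S Com τ i
    priorityVisible σ τ σ≺τ i σ∈Σi k τ∈Σk = proj₂ (proj₂ deployable) σ τ k i σ≺τ σ∈Σi τ∈Σk

    globally⇒distributively : ∀ c σ → GloballyEnabled S c σ → DistributivelyEnabled S Com c σ
    globally⇒distributively c σ (joint , noHigher) =
        (λ i σ∈Σi → sharedVisible σ i σ∈Σi , joint i σ∈Σi)
      , λ τ σ≺τ → priorityVisible σ τ σ≺τ
                , ¬joint⇒blocker c τ (λ jointτ → noHigher (τ , σ≺τ , jointτ))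

  -- This direction does not use deployability: the visibility conditions
  -- are simply discarded.
  distributively⇒globally : ∀ Com c σ → DistributivelyEnabled S Com c σ → GloballyEnabled S c σ
  distributively⇒globally Com c σ (participants , higher) =
      (λ i σ∈Σi → proj₂ (participants i σ∈Σi))
    , λ (τ , σ≺τ , jointτ) → blocker⇒¬joint c τ (proj₂ (higher τ σ≺τ)) jointτ

proposition1 : (S : System) (Com : ComArch S) → Deployable S Com → (c : Config S) → ((σ : Fin (System.nΣ S)) → GloballyEnabled S c σ → DistributivelyEnabled S Com c σ) × ((σ : Fin (System.nΣ S)) → DistributivelyEnabled S Com c σ ⇔ GloballyEnabled S c σ) × (((σ : Fin (System.nΣ S)) → ¬ DistributivelyEnabled S Com c σ) → (σ : Fin (System.nΣ S)) → ¬ GloballyEnabled S c σ)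
proposition1 S Com deployable c = partA , partB , partC
  where
  partA : ∀ σ → GloballyEnabled S c σ → DistributivelyEnabled S Com c σ
  partA = globally⇒distributively S Com deployable c

  partB : ∀ σ → DistributivelyEnabled S Com c σ ⇔ GloballyEnabled S c σ
  partB σ = mk⇔ (distributively⇒globally S Com c σ) (partA σ)

  partC : (∀ σ → ¬ DistributivelyEnabled S Com c σ) → ∀ σ → ¬ GloballyEnabled S c σ
  partC noneDistributed σ enabled = noneDistributed σ (partA σ enabled)
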